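{- For every $n\ge2$, $C(2w_n)=C(2v_{n+1})$, where $w_n=x_1x_2\cdots x_n(x_1^2+1)$ and $v_{n+1}=x_1x_2\cdots x_{n+1}(x_1+x_2)$.
   Context: Arithmetic is in $\mathbb{Z}_8$. For an operation $g$, $C(g)$ denotes the clone on $\mathbb{Z}_8$ generated by $g$, the binary addition and all unary constant operations. -}

module Defs where

open import Data.Nat as ℕ using (ℕ; zero; suc)
open import Data.Nat.DivMod using (_mod_)
open import Data.Fin using (Fin; toℕ; zero; suc)
open import Data.Product using (Σ; _×_)
open import Relation.Binary.PropositionalEquality using (_≡_)

ℤ₈ : Set
ℤ₈ = Fin 8

infixl 6 _⊕_
infixl 7 _⊗_

_⊕_ : ℤ₈ → ℤ₈ → ℤ₈
a ⊕ b = (toℕ a ℕ.+ toℕ b) mod 8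

_⊗_ : ℤ₈ → ℤ₈ → ℤ₈
a ⊗ b = (toℕ a ℕ.* toℕ b) mod 8

c₀ c₁ c₂ : ℤ₈
c₀ = zero
c₁ = suc zero
c₂ = suc (suc zero)

Op : ℕ → Set
Op k = (Fin k → ℤ₈) → ℤ₈

data Term (m : ℕ) (k : ℕ) : Set where
  var   : Fin k → Term m k
  const : ℤ₈ → Term m k
  add   : Term m k → Term m k → Term m k
  app   : (Fin m → Term m k) → Term m k

eval : ∀ {m k} → Op m → Term m k → Op k
eval g (var i)   x = x i
eval g (const c) x = c
eval g (add s t) x = eval g s x ⊕ eval g t x
eval g (app ts)  x = g (λ j → eval g (ts j) x)

-- f ∈ C(g): f is a term operation built from g, +, and constants
-- (i.e. f belongs to the clone generated by g, + and all constants).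
_∈C_ : ∀ {k m} → Op k → Op m → Set
_∈C_ {k} {m} f g = Σ (Term m k) λ t → ∀ x → eval g t x ≡ f x

SameClone : ∀ {m m'} → Op m → Op m' → Set
SameClone g h = ∀ k (f : Op k) → (f ∈C g → f ∈C h) × (f ∈C h → f ∈C g)

prod : ∀ {n} → (Fin n → ℤ₈) → ℤ₈
prod {zero}  x = c₁
prod {suc n} x = x zero ⊗ prod (λ i → x (suc i))

-- x₁ (only used for n ≥ 1; default 0 otherwise)
x₁ : ∀ {n} → (Fin n → ℤ₈) → ℤ₈
x₁ {zero}  x = c₀
x₁ {suc n} x = x zero

-- x₂ (only used for n ≥ 2; default 0 otherwise)
x₂ : ∀ {n} → (Fin n → ℤ₈) → ℤ₈
x₂ {suc (suc n)} x = x (suc zero)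
x₂ {_}           x = c₀

twoW : (n : ℕ) → Op n
twoW n x = c₂ ⊗ (prod x ⊗ (x₁ x ⊗ x₁ x ⊕ c₁))

twoV : (n : ℕ) → Op (suc n)
twoV n x = c₂ ⊗ (prod x ⊗ (x₁ x ⊕ x₂ x))

{-# OPTIONS --safe #-}
module Submission where

-- Since + and the constants belong to every clone considered, C(g) = C(h)
-- as soon as g ∈ C(h) and h ∈ C(g). With p the product of the remaining
-- variables,
--   2w_n(a, b, …)        = 2v_{n+1}(a, a, b, …) + 2v_{n+1}(a, b, a + 1, …),
--   2v_{n+1}(a, b, …)    = 2w_n(a + b, …) + 2w_n(a, …) + 2w_n(b, …),
-- i.e. 2abp(a² + 1) = 4a³bp + 2ab(a + 1)p(a + b) and
-- 2abp(a + b) = 2(a + b)p((a + b)² + 1) + 2ap(a² + 1) + 2bp(b² + 1) in ℤ₈.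
-- Both hold because a(a + 1) and ab(a + b) are always even; being identities
-- in three variables over ℤ₈, they are checked exhaustively.

open import Defs
open import Data.Nat using (ℕ; _≤_; zero; suc; s≤s; z≤n)
open import Data.Fin using (Fin; zero; suc)
open import Data.Fin.Properties using (all?) renaming (_≟_ to _≟ᶠ_)
open import Data.Product using (_,_)
open import Data.Vec.Functional using (_∷_; tail)
open import Function using (_∘_)
open import Function.Definitions using (Congruent)
open import Relation.Nullary.Decidable using (toWitness)
open import Relation.Binary.PropositionalEquality
  using (_≡_; _≗_; refl; cong₂; trans)

-- Without function extensionality, evaluating a substituted term needs the
-- generator to respect pointwise equality of its arguments.
OpCongruent : ∀ {m} → Op m → Set
OpCongruent = Congruent _≗_ _≡_

sub : ∀ {m k j} → Term m k → (Fin k → Term m j) → Term m j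
sub (var i)   σ = σ i
sub (const c) σ = const c
sub (add s t) σ = add (sub s σ) (sub t σ)
sub (app ts)  σ = app (λ i → sub (ts i) σ)

eval-sub : ∀ {m k j} {g : Op m} → OpCongruent g →
           (t : Term m k) (σ : Fin k → Term m j) (x : Fin j → ℤ₈) →
           eval g (sub t σ) x ≡ eval g t (λ i → eval g (σ i) x)
eval-sub g-cong (var i)   σ x = refl
eval-sub g-cong (const c) σ x = refl
eval-sub g-cong (add s t) σ x = cong₂ _⊕_ (eval-sub g-cong s σ x) (eval-sub g-cong t σ x)
eval-sub g-cong (app ts)  σ x = g-cong (λ i → eval-sub g-cong (ts i) σ x)

module Translate {m m'} {g : Op m} {h : Op m'} (g-cong : OpCongruent g) (h-cong : OpCongruent h)
                 (tg : Term m' m) (tg-correct : ∀ x → eval h tg x ≡ g x) where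

  translate : ∀ {k} → Term m k → Term m' k
  translate (var i)   = var i
  translate (const c) = const c
  translate (add s t) = add (translate s) (translate t)
  translate (app ts)  = sub tg (translate ∘ ts)

  eval-translate : ∀ {k} (t : Term m k) x → eval h (translate t) x ≡ eval g t x
  eval-translate (var i)   x = refl
  eval-translate (const c) x = refl
  eval-translate (add s t) x = cong₂ _⊕_ (eval-translate s x) (eval-translate t x)
  eval-translate (app ts)  x =
    trans (eval-sub h-cong tg (translate ∘ ts) x)
          (trans (tg-correct _) (g-cong (λ j → eval-translate (ts j) x)))

∈C-trans : ∀ {k m m'} {f : Op k} {g : Op m} {h : Op m'} → OpCongruent g → OpCongruent h →
           f ∈C g → g ∈C h → f ∈C h
∈C-trans g-cong h-cong (t , t-correct) (tg , tg-correct) =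
  translate t , λ x → trans (eval-translate t x) (t-correct x)
  where open Translate g-cong h-cong tg tg-correct

SameClone-intro : ∀ {m m'} {g : Op m} {h : Op m'} → OpCongruent g → OpCongruent h →
                  g ∈C h → h ∈C g → SameClone g h
SameClone-intro g-cong h-cong g∈h h∈g k f =
  (λ f∈g → ∈C-trans g-cong h-cong f∈g g∈h) , (λ f∈h → ∈C-trans h-cong g-cong f∈h h∈g)

prod-cong : ∀ {n} → OpCongruent (prod {n})
prod-cong {zero}  eq = refl
prod-cong {suc n} eq = cong₂ _⊗_ (eq zero) (prod-cong (eq ∘ suc))

x₁-cong : ∀ {n} → OpCongruent (x₁ {n})
x₁-cong {zero}  eq = refl
x₁-cong {suc n} eq = eq zero

x₂-cong : ∀ {n} → OpCongruent (x₂ {n})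
x₂-cong {zero}        eq = refl
x₂-cong {suc zero}    eq = refl
x₂-cong {suc (suc n)} eq = eq (suc zero)

twoW-cong : ∀ n → OpCongruent (twoW n)
twoW-cong _ eq =
  cong₂ (λ a p → c₂ ⊗ (p ⊗ (a ⊗ a ⊕ c₁))) (x₁-cong eq) (prod-cong eq)

twoV-cong : ∀ n → OpCongruent (twoV n)
twoV-cong _ eq =
  cong₂ (λ s p → c₂ ⊗ (p ⊗ s)) (cong₂ _⊕_ (x₁-cong eq) (x₂-cong eq)) (prod-cong eq)

-- Bracketed exactly as twoV and twoW unfold on the arguments used below.
twoW≡twoV+twoV-ℤ₈ : ∀ a b p →
  c₂ ⊗ ((a ⊗ (a ⊗ (b ⊗ p))) ⊗ (a ⊕ a)) ⊕ c₂ ⊗ ((a ⊗ (b ⊗ ((a ⊕ c₁) ⊗ p))) ⊗ (a ⊕ b))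
    ≡ c₂ ⊗ ((a ⊗ (b ⊗ p)) ⊗ (a ⊗ a ⊕ c₁))
twoW≡twoV+twoV-ℤ₈ =
  toWitness {a? = all? λ a → all? λ b → all? λ p → _ ≟ᶠ _} _

twoV≡twoW+twoW+twoW-ℤ₈ : ∀ a b p →
  c₂ ⊗ (((a ⊕ b) ⊗ p) ⊗ ((a ⊕ b) ⊗ (a ⊕ b) ⊕ c₁))
    ⊕ c₂ ⊗ ((a ⊗ p) ⊗ (a ⊗ a ⊕ c₁)) ⊕ c₂ ⊗ ((b ⊗ p) ⊗ (b ⊗ b ⊕ c₁))
    ≡ c₂ ⊗ ((a ⊗ (b ⊗ p)) ⊗ (a ⊕ b))
twoV≡twoW+twoW+twoW-ℤ₈ =
  toWitness {a? = all? λ a → all? λ b → all? λ p → _ ≟ᶠ _} _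

module _ {m : ℕ} where
  private
    n : ℕ
    n = suc (suc m)

    laterVars : ∀ {j k} → Fin j → Term k (suc (suc j))
    laterVars i = var (suc (suc i))

  twoW≡twoV+twoV : (x : Fin n → ℤ₈) →
    twoV n (x zero ∷ x zero ∷ x (suc zero) ∷ tail (tail x))
      ⊕ twoV n (x zero ∷ x (suc zero) ∷ (x zero ⊕ c₁) ∷ tail (tail x))
      ≡ twoW n x
  twoW≡twoV+twoV x = twoW≡twoV+twoV-ℤ₈ (x zero) (x (suc zero)) (prod (tail (tail x)))

  twoV≡twoW+twoW+twoW : (x : Fin (suc n) → ℤ₈) →
    twoW n ((x zero ⊕ x (suc zero)) ∷ tail (tail x))
      ⊕ twoW n (x zero ∷ tail (tail x)) ⊕ twoW n (x (suc zero) ∷ tail (tail x))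
      ≡ twoV n x
  twoV≡twoW+twoW+twoW x = twoV≡twoW+twoW+twoW-ℤ₈ (x zero) (x (suc zero)) (prod (tail (tail x)))

  twoW∈CtwoV : twoW n ∈C twoV n
  twoW∈CtwoV =
    add (app (var zero ∷ var zero ∷ var (suc zero) ∷ laterVars))
        (app (var zero ∷ var (suc zero) ∷ add (var zero) (const c₁) ∷ laterVars))
    , twoW≡twoV+twoV

  twoV∈CtwoW : twoV n ∈C twoW n
  twoV∈CtwoW =
    add (add (app (add (var zero) (var (suc zero)) ∷ laterVars))
             (app (var zero ∷ laterVars)))
        (app (var (suc zero) ∷ laterVars))
    , twoV≡twoW+twoW+twoW

lemma4p5 : (n : ℕ) → 2 ≤ n → SameClone (twoW n) (twoV n)
lemma4p5 (suc (suc m)) (s≤s (s≤s z≤n)) =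
  SameClone-intro (twoW-cong _) (twoV-cong _) twoW∈CtwoV twoV∈CtwoW
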